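{- Let $\mathcal{P}$ be a natural unit interval order on $[1,n]$. If $w,w'\in\mathfrak{S}_n$ are connected by a $\mathcal{P}$-Knuth move, then $|\mathrm{finv}_\mathcal{P}(w)|=|\mathrm{finv}_\mathcal{P}(w')|$. Consequently the fake $\mathcal{P}$-inversion number is constant on any connected $\mathcal{P}$-Knuth equivalence graph (i.e. on any $\mathcal{P}$-Knuth equivalence class).
   Context: A natural unit interval order on $[1,n]$ is a partial order $\prec$ with (i) $a\prec b\Rightarrow a<b$, and (ii) if $b\prec c$ and $a$ is incomparable to both $b,c$ then $b<a<c$. $\mathrm{finv}_\mathcal{P}(w)$ is the set of pairs $(i,j)$ with $j<i$, $i$ and $j$ incomparable in $\mathcal{P}$, and $i$ appearing before $j$ in the word $w$. $\mathcal{P}$-Knuth moves: for $a<b<c$ with $a\prec c$, replace three consecutive letters as follows: (1) $a,b$ incomparable and $b,c$ incomparable: $bca\leftrightarrow cab$; (2) $a\prec b$, $b,c$ incomparable: $bca\leftrightarrow bac$, $cba\leftrightarrow cab$; (3) $a,b$ incomparable, $b\prec c$: $bca\leftrightarrow cba$, $acb\leftrightarrow cab$; (4) $a\prec b\prec c$: $bca\leftrightarrow bac$, $acb\leftrightarrow cab$. -}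

module Defs where

open import Data.Nat using (ℕ; _+_)
open import Data.Fin using (Fin; _<_)
open import Data.List using (List; []; _∷_; _++_; length; filter; allFin)
open import Data.List.Relation.Binary.Permutation.Propositional using (_↭_)
open import Data.Product using (_×_; _,_)
open import Data.Sum using (_⊎_)
open import Relation.Nullary using (¬_; Dec)
open import Relation.Nullary.Decidable using (_×-dec_; ¬?)
open import Relation.Binary.Construct.Closure.Equivalence using (EqClosure)
import Data.Fin.Properties as FinP

-- A natural unit interval order on [1,n], with [1,n] modelled by Fin n
-- (element k of Fin n stands for k+1; the natural order is Fin's _<_).
record NUIO (n : ℕ) : Set₁ where
  field
    _≺_      : Fin n → Fin n → Set
    ≺-dec    : ∀ a b → Dec (a ≺ b)
    ≺-irrefl : ∀ a → ¬ (a ≺ a)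
    ≺-trans  : ∀ {a b c} → a ≺ b → b ≺ c → a ≺ c
    ≺⇒<      : ∀ {a b} → a ≺ b → a < b
    natural  : ∀ {a b c} → b ≺ c →
               ¬ (a ≺ b) → ¬ (b ≺ a) → ¬ (a ≺ c) → ¬ (c ≺ a) →
               (b < a × a < c)

module _ {n : ℕ} (P : NUIO n) where
  open NUIO P

  Incomp : Fin n → Fin n → Set
  Incomp a b = ¬ (a ≺ b) × ¬ (b ≺ a)

  incomp? : ∀ a b → Dec (Incomp a b)
  incomp? a b = ¬? (≺-dec a b) ×-dec ¬? (≺-dec b a)

  -- |finv_P(w)|: number of pairs (i,j) with j < i, i and j incomparable,
  -- and i appearing before j in w.  For each letter i, count the later
  -- letters j with j < i and j incomparable to i.
  finvCount : List (Fin n) → ℕ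
  finvCount []       = 0
  finvCount (i ∷ js) =
    length (filter (λ j → FinP._<?_ j i ×-dec incomp? i j) js) + finvCount js

  -- Triples xyz ↦ x'y'z' allowed as P-Knuth moves (one listed direction
  -- each; the move relation below is symmetrised).  Always a < b < c, a ≺ c.
  data KnuthTriple : Fin n → Fin n → Fin n → Fin n → Fin n → Fin n → Set where
    k1   : ∀ {a b c} → a < b → b < c → a ≺ c → Incomp a b → Incomp b c →
           KnuthTriple b c a c a b
    k2a  : ∀ {a b c} → a < b → b < c → a ≺ c → a ≺ b → Incomp b c →
           KnuthTriple b c a b a c
    k2b  : ∀ {a b c} → a < b → b < c → a ≺ c → a ≺ b → Incomp b c →
           KnuthTriple c b a c a b
    k3a  : ∀ {a b c} → a < b → b < c → a ≺ c → Incomp a b → b ≺ c →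
           KnuthTriple b c a c b a
    k3b  : ∀ {a b c} → a < b → b < c → a ≺ c → Incomp a b → b ≺ c →
           KnuthTriple a c b c a b
    k4a  : ∀ {a b c} → a < b → b < c → a ≺ c → a ≺ b → b ≺ c →
           KnuthTriple b c a b a c
    k4b  : ∀ {a b c} → a < b → b < c → a ≺ c → a ≺ b → b ≺ c →
           KnuthTriple a c b c a b

  data KnuthStep : List (Fin n) → List (Fin n) → Set where
    step : ∀ u v {x y z x' y' z'} → KnuthTriple x y z x' y' z' →
           KnuthStep (u ++ x ∷ y ∷ z ∷ v) (u ++ x' ∷ y' ∷ z' ∷ v)

  KnuthMove : List (Fin n) → List (Fin n) → Set
  KnuthMove w w' = KnuthStep w w' ⊎ KnuthStep w' w

  KnuthEquiv : List (Fin n) → List (Fin n) → Set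
  KnuthEquiv = EqClosure KnuthStep

IsPerm : ∀ {n} → List (Fin n) → Set
IsPerm {n} w = w ↭ allFin n

-- A P-Knuth move permutes three adjacent letters, so every pair with one
-- letter outside the triple keeps its relative order, and only the pairs
-- inside the triple matter. In cases (2)–(4) the move is a single swap of
-- two adjacent P-comparable letters, which never form a fake inversion. In
-- case (1), bca ↦ cab, both words reach cba by one swap of an adjacent
-- incomparable pair into decreasing order, which adds exactly one fake
-- inversion each time.
module Submission where

open import Defs
open import Data.Nat using (ℕ; suc; _+_)
open import Data.Nat.Properties using (+-commutativeSemigroup; suc-injective)
open import Algebra.Properties.CommutativeSemigroup +-commutativeSemigroup using (x∙yz≈y∙xz)
open import Data.Fin using (Fin; _<_; _<?_)
open import Data.Fin.Properties using (<-asym)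
open import Data.List using (List; []; _∷_; _++_; length; filter)
open import Data.List.Properties using (filter-accept; filter-reject)
open import Data.List.Relation.Binary.Permutation.Propositional
  using (_↭_; refl; prep; swap; trans)
open import Data.List.Relation.Binary.Permutation.Propositional.Properties
  using (↭-length; filter-↭; ++⁺ˡ)
open import Data.Product using (_×_; _,_; proj₁; proj₂)
import Data.Product as Product
open import Data.Sum using (inj₁; inj₂)
open import Relation.Nullary using (Dec; ¬_)
open import Relation.Nullary.Decidable using (_×-dec_)
open import Relation.Binary.PropositionalEquality as ≡ using (_≡_; cong; cong₂; sym)
open import Relation.Binary.Construct.Closure.ReflexiveTransitive using (ε; _◅_)
open import Relation.Binary.Construct.Closure.Symmetric using (SymClosure; fwd; bwd)

module _ {n : ℕ} (P : NUIO n) where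
  open NUIO P

  FakeInversion : Fin n → Fin n → Set
  FakeInversion i j = j < i × Incomp P i j

  fakeInversion? : ∀ i j → Dec (FakeInversion i j)
  fakeInversion? i j = j <? i ×-dec incomp? P i j

  -- finvCount P (i ∷ js) unfolds to  finvWith i js + finvCount P js.
  finvWith : Fin n → List (Fin n) → ℕ
  finvWith i js = length (filter (fakeInversion? i) js)

  finvWith-accept : ∀ {i j} js → FakeInversion i j →
                    finvWith i (j ∷ js) ≡ suc (finvWith i js)
  finvWith-accept js p = cong length (filter-accept (fakeInversion? _) p)

  finvWith-reject : ∀ {i j} js → ¬ FakeInversion i j →
                    finvWith i (j ∷ js) ≡ finvWith i js
  finvWith-reject js ¬p = cong length (filter-reject (fakeInversion? _) ¬p)

  finvWith-↭ : ∀ i {w w'} → w ↭ w' → finvWith i w ≡ finvWith i w'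
  finvWith-↭ i w↭w' = ↭-length (filter-↭ (fakeInversion? i) w↭w')

  finvCount-∷-shift : ∀ x {w w'} k → w ↭ w' → finvCount P w' ≡ k + finvCount P w →
                      finvCount P (x ∷ w') ≡ k + finvCount P (x ∷ w)
  finvCount-∷-shift x {w} {w'} k w↭w' eq = begin
    finvWith x w' + finvCount P w'       ≡⟨ cong₂ _+_ (sym (finvWith-↭ x w↭w')) eq ⟩
    finvWith x w + (k + finvCount P w)   ≡⟨ x∙yz≈y∙xz (finvWith x w) k (finvCount P w) ⟩
    k + (finvWith x w + finvCount P w)   ∎
    where open ≡.≡-Reasoning

  finvCount-++-shift : ∀ u {w w'} k → w ↭ w' → finvCount P w' ≡ k + finvCount P w →
                       finvCount P (u ++ w') ≡ k + finvCount P (u ++ w)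
  finvCount-++-shift []      k w↭w' eq = eq
  finvCount-++-shift (x ∷ u) k w↭w' eq =
    finvCount-∷-shift x k (++⁺ˡ u w↭w') (finvCount-++-shift u k w↭w' eq)

  finvCount-swap-≺ : ∀ {x y} v → x ≺ y →
                     finvCount P (y ∷ x ∷ v) ≡ finvCount P (x ∷ y ∷ v)
  finvCount-swap-≺ {x} {y} v x≺y = begin
    finvWith y (x ∷ v) + (finvWith x v + finvCount P v)
      ≡⟨ cong (_+ _) (finvWith-reject v (λ yx → proj₂ (proj₂ yx) x≺y)) ⟩
    finvWith y v + (finvWith x v + finvCount P v)
      ≡⟨ x∙yz≈y∙xz (finvWith y v) (finvWith x v) (finvCount P v) ⟩
    finvWith x v + (finvWith y v + finvCount P v)
      ≡⟨ cong (_+ _) (finvWith-reject v (λ xy → proj₁ (proj₂ xy) x≺y)) ⟨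
    finvWith x (y ∷ v) + (finvWith y v + finvCount P v)   ∎
    where open ≡.≡-Reasoning

  finvCount-swap-incomparable : ∀ {x y} v → x < y → Incomp P x y →
                                finvCount P (y ∷ x ∷ v) ≡ suc (finvCount P (x ∷ y ∷ v))
  finvCount-swap-incomparable {x} {y} v x<y x∥y = begin
    finvWith y (x ∷ v) + (finvWith x v + finvCount P v)
      ≡⟨ cong (_+ _) (finvWith-accept v (x<y , Product.swap x∥y)) ⟩
    suc (finvWith y v + (finvWith x v + finvCount P v))
      ≡⟨ cong suc (x∙yz≈y∙xz (finvWith y v) (finvWith x v) (finvCount P v)) ⟩
    suc (finvWith x v + (finvWith y v + finvCount P v))
      ≡⟨ cong (λ m → suc (m + _)) (finvWith-reject v (λ xy → <-asym x<y (proj₁ xy))) ⟨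
    suc (finvWith x (y ∷ v) + (finvWith y v + finvCount P v))   ∎
    where open ≡.≡-Reasoning

  knuthTriple-↭ : ∀ {x y z x' y' z'} → KnuthTriple P x y z x' y' z' →
                  ∀ v → x ∷ y ∷ z ∷ v ↭ x' ∷ y' ∷ z' ∷ v
  knuthTriple-↭ (k1  {a} {b} {c} _ _ _ _ _) v = trans (swap b c refl) (prep c (swap b a refl))
  knuthTriple-↭ (k2a {a} {b} {c} _ _ _ _ _) v = prep b (swap c a refl)
  knuthTriple-↭ (k2b {a} {b} {c} _ _ _ _ _) v = prep c (swap b a refl)
  knuthTriple-↭ (k3a {b = b} {c} _ _ _ _ _) v = swap b c refl
  knuthTriple-↭ (k3b {a} {c = c} _ _ _ _ _) v = swap a c refl
  knuthTriple-↭ (k4a {a} {b} {c} _ _ _ _ _) v = prep b (swap c a refl)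
  knuthTriple-↭ (k4b {a} {c = c} _ _ _ _ _) v = swap a c refl

  finvCount-knuthTriple : ∀ {x y z x' y' z'} → KnuthTriple P x y z x' y' z' →
                          ∀ v → finvCount P (x' ∷ y' ∷ z' ∷ v) ≡ finvCount P (x ∷ y ∷ z ∷ v)
  finvCount-knuthTriple (k1 {a} {b} {c} a<b b<c _ a∥b b∥c) v =
    suc-injective (≡.trans (sym cab→cba) bca→cba)
    where
    bca→cba : finvCount P (c ∷ b ∷ a ∷ v) ≡ suc (finvCount P (b ∷ c ∷ a ∷ v))
    bca→cba = finvCount-swap-incomparable (a ∷ v) b<c b∥c
    cab→cba : finvCount P (c ∷ b ∷ a ∷ v) ≡ suc (finvCount P (c ∷ a ∷ b ∷ v))
    cab→cba = finvCount-∷-shift c 1 (swap a b refl) (finvCount-swap-incomparable v a<b a∥b)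
  finvCount-knuthTriple (k2a {a} {b} {c} _ _ a≺c _ _) v =
    finvCount-∷-shift b 0 (swap c a refl) (sym (finvCount-swap-≺ v a≺c))
  finvCount-knuthTriple (k2b {a} {b} {c} _ _ _ a≺b _) v =
    finvCount-∷-shift c 0 (swap b a refl) (sym (finvCount-swap-≺ v a≺b))
  finvCount-knuthTriple (k3a {a} _ _ _ _ b≺c) v = finvCount-swap-≺ (a ∷ v) b≺c
  finvCount-knuthTriple (k3b {b = b} _ _ a≺c _ _) v = finvCount-swap-≺ (b ∷ v) a≺c
  finvCount-knuthTriple (k4a {a} {b} {c} _ _ a≺c _ _) v =
    finvCount-∷-shift b 0 (swap c a refl) (sym (finvCount-swap-≺ v a≺c))
  finvCount-knuthTriple (k4b {b = b} _ _ a≺c _ _) v = finvCount-swap-≺ (b ∷ v) a≺c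

  finvCount-knuthStep : ∀ {w w'} → KnuthStep P w w' → finvCount P w ≡ finvCount P w'
  finvCount-knuthStep (step u v t) =
    sym (finvCount-++-shift u 0 (knuthTriple-↭ t v) (finvCount-knuthTriple t v))

  finvCount-knuthMove : ∀ {w w'} → KnuthMove P w w' → finvCount P w ≡ finvCount P w'
  finvCount-knuthMove (inj₁ s) = finvCount-knuthStep s
  finvCount-knuthMove (inj₂ s) = sym (finvCount-knuthStep s)

  finvCount-knuthEquiv : ∀ {w w'} → KnuthEquiv P w w' → finvCount P w ≡ finvCount P w'
  finvCount-knuthEquiv ε        = ≡.refl
  finvCount-knuthEquiv (s ◅ ss) =
    ≡.trans (finvCount-knuthMove (toMove s)) (finvCount-knuthEquiv ss)
    where
    toMove : ∀ {w w'} → SymClosure (KnuthStep P) w w' → KnuthMove P w w'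
    toMove (fwd t) = inj₁ t
    toMove (bwd t) = inj₂ t

lemma4p13 : ∀ {n : ℕ} (P : NUIO n) →
    (∀ (w w' : List (Fin n)) → IsPerm w → IsPerm w' →
       KnuthMove P w w' → finvCount P w ≡ finvCount P w')
    × (∀ (w w' : List (Fin n)) → IsPerm w → IsPerm w' →
       KnuthEquiv P w w' → finvCount P w ≡ finvCount P w')
lemma4p13 P = (λ _ _ _ _ → finvCount-knuthMove P) , (λ _ _ _ _ → finvCount-knuthEquiv P)
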